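{- For non-negative integers $m$, $n$ and any integer $r$, \[ \sum_{k=1}^nk^mF_{k + r} = P_1(m,n)F_{n+r} + P_2(m,n)F_{n+r+1} + C(m,r),\qquad \sum_{k=1}^nk^mL_{k + r} = P_1(m,n)L_{n+r} + P_2(m,n)L_{n+r+1} + K(m,r), \] where \[ P_1 (m,n) = n^m + \sum_{s = 1}^m ( - 1)^{s} \binom ms n^{m - s} \sum_{j = 1}^s A(s,j)F_{j + s},\qquad P_2 (m,n) = n^m + \sum_{s = 1}^m ( - 1)^{s} \binom ms n^{m - s} \sum_{j = 1}^s A(s,j)F_{j + s + 1}, \] \[ C(m,r) = - \delta _{m,0} F_r + ( - 1)^{m + 1} \sum_{j = 0}^m A(m,j)F_{j + m + r + 1},\qquad K(m,r) = - \delta _{m,0} L_r + ( - 1)^{m + 1} \sum_{j = 0}^m A(m,j)L_{j + m + r + 1}. \]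
   Context: $F_j$, $L_j$ are the Fibonacci and Lucas numbers for all integers $j$ ($F_0=0,F_1=1,L_0=2,L_1=1$, $X_j=X_{j-1}+X_{j-2}$, extended to negative indices by the same recurrence). $\delta_{m,0}$ is the Kronecker delta. The Eulerian numbers are $A(i,j)=\sum_{t=0}^j(-1)^t\binom{i+1}{t}(j-t)^i$ for non-negative integers $i,j$, with $0^0=1$. Empty sums are $0$. -}

module Defs where

open import Data.Nat as ℕ using (ℕ; zero; suc)
open import Data.Nat.Combinatorics using (_C_)
open import Data.Integer using (ℤ; +_; -[1+_]; _+_; _-_; _*_; -_; 0ℤ; 1ℤ)
open import Data.Integer using () renaming (_^_ to _^ℤ_)

-- Sequence satisfying X_j = X_{j-1} + X_{j-2} for all integers j,
-- with X_0 = a, X_1 = b.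
-- Forward: pair (X_n , X_{n+1}) for n : ℕ.
fwd : ℤ → ℤ → ℕ → ℤ
fwd a b zero    = a
fwd a b (suc n) = fwd b (a + b) n

-- Backward: X_{-n}; uses X_{j-2} = X_j - X_{j-1}.
-- bwd a b n = X_{-n} where X_0 = a, X_1 = b.
bwd : ℤ → ℤ → ℕ → ℤ
bwd a b zero    = a
bwd a b (suc n) = bwd (b - a) a n

seqℤ : ℤ → ℤ → ℤ → ℤ
seqℤ a b (+ n)      = fwd a b n
seqℤ a b -[1+ n ]   = bwd a b (suc n)

F : ℤ → ℤ
F = seqℤ 0ℤ 1ℤ

L : ℤ → ℤ
L = seqℤ (+ 2) 1ℤ

-- Sum_{k=a}^{b} f k over naturals (empty = 0 when b < a).
-- sumFrom a n f = f a + f (a+1) + ... + f (a+n-1)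
sumFrom : ℕ → ℕ → (ℕ → ℤ) → ℤ
sumFrom a zero    f = 0ℤ
sumFrom a (suc n) f = f a + sumFrom (suc a) n f

Σ[_⋯_] : ℕ → ℕ → (ℕ → ℤ) → ℤ
Σ[ a ⋯ b ] f = sumFrom a (suc b ℕ.∸ a) f

-- natural power with 0^0 = 1
pow : ℕ → ℕ → ℤ
pow x e = + (x ℕ.^ e)

sgn : ℕ → ℤ
sgn e = (- 1ℤ) ^ℤ e

Eul : ℕ → ℕ → ℤ
Eul i j = Σ[ 0 ⋯ j ] (λ t → sgn t * (+ ((suc i) C t)) * pow (j ℕ.∸ t) i)

δ0 : ℕ → ℤ
δ0 zero    = 1ℤ
δ0 (suc _) = 0ℤ

P₁ : ℕ → ℕ → ℤ
P₁ m n = pow n m + Σ[ 1 ⋯ m ] (λ s → sgn s * (+ (m C s)) * pow n (m ℕ.∸ s)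
           * Σ[ 1 ⋯ s ] (λ j → Eul s j * F (+ (j ℕ.+ s))))

P₂ : ℕ → ℕ → ℤ
P₂ m n = pow n m + Σ[ 1 ⋯ m ] (λ s → sgn s * (+ (m C s)) * pow n (m ℕ.∸ s)
           * Σ[ 1 ⋯ s ] (λ j → Eul s j * F (+ (j ℕ.+ s ℕ.+ 1))))

Cc : ℕ → ℤ → ℤ
Cc m r = - (δ0 m * F r) + sgn (m ℕ.+ 1) * Σ[ 0 ⋯ m ] (λ j → Eul m j * F (+ (j ℕ.+ m ℕ.+ 1) + r))

Kc : ℕ → ℤ → ℤ
Kc m r = - (δ0 m * L r) + sgn (m ℕ.+ 1) * Σ[ 0 ⋯ m ] (λ j → Eul m j * L (+ (j ℕ.+ m ℕ.+ 1) + r))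

{-# OPTIONS --safe #-}
-- The divergent sum Σ_{k ≥ n} k^m X(k + r) has a natural finite value T(n).  On a sequence with
-- X(k + 2) = X(k + 1) + X(k) the shift E satisfies 1 - E = - E⁻¹, so in
-- Σ_k g(k) E^k = (Σ_v A_g(v) E^v) / (1 - E)^(N + 1), valid for polynomials g of degree ≤ N with
-- Eulerian-type numerators A_g(v), dividing by (1 - E)^(N + 1) amounts to applying (- E)^(N + 1).  Since
-- T(n) - T(n + 1) = n^m X(n + r), the sum telescopes to T(0) - T(n + 1); T(0) is the constant term,
-- and expanding (n + x)^m binomially inside T(n) and writing X(j + q + 1) = F(j) X(q) + F(j + 1) X(q + 1)
-- produces P₁ and P₂.
module Submission where

open import Defs
open import Data.Nat using (ℕ)
open import Data.Integer using (ℤ; +_; _+_; _*_)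
open import Data.Product using (_×_; _,_)
open import Relation.Binary.PropositionalEquality using (_≡_)

open import Data.Nat as ℕ using (zero; suc; _≤_; _<_; z≤n; s≤s)
open import Data.Nat.Combinatorics using (_C_; nCk+nC[k+1]≡[n+1]C[k+1]; k>n⇒nCk≡0; nCn≡1)
import Data.Nat.Properties as ℕP
open import Data.Integer using (-[1+_]; _-_; -_; 0ℤ; 1ℤ)
import Data.Integer.Properties as ℤP
open import Data.Integer.Tactic.RingSolver using (solve-∀)
open import Relation.Binary.PropositionalEquality using (refl; sym; trans; cong; cong₂; module ≡-Reasoning)
open ≡-Reasoning

-- Finite sums

sumFrom-cong-< : ∀ a n {f g : ℕ → ℤ} → (∀ i → a ≤ i → i < a ℕ.+ n → f i ≡ g i) →
                 sumFrom a n f ≡ sumFrom a n g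
sumFrom-cong-< a zero    f≗g = refl
sumFrom-cong-< a (suc n) f≗g =
  cong₂ _+_ (f≗g a ℕP.≤-refl (ℕP.m<m+n a (s≤s z≤n)))
            (sumFrom-cong-< (suc a) n λ i a<i i<a+1+n →
              f≗g i (ℕP.<⇒≤ a<i) (ℕP.<-≤-trans i<a+1+n (ℕP.≤-reflexive (sym (ℕP.+-suc a n)))))

sumFrom-cong : ∀ a n {f g : ℕ → ℤ} → (∀ i → f i ≡ g i) → sumFrom a n f ≡ sumFrom a n g
sumFrom-cong a n f≗g = sumFrom-cong-< a n λ i _ _ → f≗g i

sumFrom-zero : ∀ a n {f : ℕ → ℤ} → (∀ i → a ≤ i → i < a ℕ.+ n → f i ≡ 0ℤ) →
               sumFrom a n f ≡ 0ℤ
sumFrom-zero a zero    f≗0 = refl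
sumFrom-zero a (suc n) f≗0 = trans (sumFrom-cong-< a (suc n) f≗0) (sum0 a (suc n))
  where
  sum0 : ∀ a n → sumFrom a n (λ _ → 0ℤ) ≡ 0ℤ
  sum0 a zero    = refl
  sum0 a (suc n) = trans (ℤP.+-identityˡ _) (sum0 (suc a) n)

sumFrom-suc : ∀ a n (f : ℕ → ℤ) → sumFrom (suc a) n f ≡ sumFrom a n (λ i → f (suc i))
sumFrom-suc a zero    f = refl
sumFrom-suc a (suc n) f = cong (_+_ (f (suc a))) (sumFrom-suc (suc a) n f)

sumFrom-snoc : ∀ a n (f : ℕ → ℤ) → sumFrom a (suc n) f ≡ sumFrom a n f + f (a ℕ.+ n)
sumFrom-snoc a zero    f =
  trans (ℤP.+-identityʳ (f a)) (trans (cong f (sym (ℕP.+-identityʳ a))) (sym (ℤP.+-identityˡ _)))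
sumFrom-snoc a (suc n) f = begin
  f a + sumFrom (suc a) (suc n) f
    ≡⟨ cong (_+_ (f a)) (sumFrom-snoc (suc a) n f) ⟩
  f a + (sumFrom (suc a) n f + f (suc a ℕ.+ n))
    ≡⟨ ℤP.+-assoc (f a) _ _ ⟨
  f a + sumFrom (suc a) n f + f (suc a ℕ.+ n)
    ≡⟨ cong (λ k → f a + sumFrom (suc a) n f + f k) (ℕP.+-suc a n) ⟨
  f a + sumFrom (suc a) n f + f (a ℕ.+ suc n) ∎

sumFrom-+ : ∀ a n (f g : ℕ → ℤ) → sumFrom a n (λ i → f i + g i) ≡ sumFrom a n f + sumFrom a n g
sumFrom-+ a zero    f g = refl
sumFrom-+ a (suc n) f g =
  trans (cong (_+_ (f a + g a)) (sumFrom-+ (suc a) n f g)) (interchange (f a) (g a) _ _)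
  where
  interchange : ∀ x y u v → x + y + (u + v) ≡ x + u + (y + v)
  interchange = solve-∀

sumFrom-*ˡ : ∀ a n c (f : ℕ → ℤ) → sumFrom a n (λ i → c * f i) ≡ c * sumFrom a n f
sumFrom-*ˡ a zero    c f = sym (ℤP.*-zeroʳ c)
sumFrom-*ˡ a (suc n) c f =
  trans (cong (_+_ (c * f a)) (sumFrom-*ˡ (suc a) n c f)) (sym (ℤP.*-distribˡ-+ c (f a) _))

sumFrom-*ʳ : ∀ a n c (f : ℕ → ℤ) → sumFrom a n (λ i → f i * c) ≡ sumFrom a n f * c
sumFrom-*ʳ a n c f = begin
  sumFrom a n (λ i → f i * c) ≡⟨ sumFrom-cong a n (λ i → ℤP.*-comm (f i) c) ⟩
  sumFrom a n (λ i → c * f i) ≡⟨ sumFrom-*ˡ a n c f ⟩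
  c * sumFrom a n f           ≡⟨ ℤP.*-comm c _ ⟩
  sumFrom a n f * c           ∎

sumFrom-- : ∀ a n (f g : ℕ → ℤ) → sumFrom a n (λ i → f i - g i) ≡ sumFrom a n f - sumFrom a n g
sumFrom-- a zero    f g = refl
sumFrom-- a (suc n) f g =
  trans (cong (_+_ (f a - g a)) (sumFrom-- (suc a) n f g)) (interchange (f a) (g a) _ _)
  where
  interchange : ∀ x y u v → x - y + (u - v) ≡ x + u - (y + v)
  interchange = solve-∀

sumFrom-telescope : ∀ a n (T : ℕ → ℤ) → sumFrom a n (λ i → T i - T (suc i)) ≡ T a - T (a ℕ.+ n)
sumFrom-telescope a zero    T =
  trans (sym (ℤP.+-inverseʳ (T a))) (cong (λ k → T a - T k) (sym (ℕP.+-identityʳ a)))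
sumFrom-telescope a (suc n) T = begin
  T a - T (suc a) + sumFrom (suc a) n (λ i → T i - T (suc i))
    ≡⟨ cong (_+_ (T a - T (suc a))) (sumFrom-telescope (suc a) n T) ⟩
  T a - T (suc a) + (T (suc a) - T (suc a ℕ.+ n))
    ≡⟨ cancel (T a) (T (suc a)) _ ⟩
  T a - T (suc a ℕ.+ n)
    ≡⟨ cong (λ k → T a - T k) (ℕP.+-suc a n) ⟨
  T a - T (a ℕ.+ suc n) ∎
  where
  cancel : ∀ x y z → x - y + (y - z) ≡ x - z
  cancel = solve-∀

sumFrom-interchange : ∀ a n b k (u w : ℕ → ℤ) (f : ℕ → ℕ → ℤ) →
  sumFrom a n (λ i → u i * sumFrom b k (λ j → w j * f i j)) ≡
  sumFrom b k (λ j → w j * sumFrom a n (λ i → u i * f i j))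
sumFrom-interchange a zero    b k u w f =
  sym (sumFrom-zero b k λ j _ _ → ℤP.*-zeroʳ (w j))
sumFrom-interchange a (suc n) b k u w f = begin
  u a * sumFrom b k (λ j → w j * f a j) + sumFrom (suc a) n (λ i → u i * sumFrom b k (λ j → w j * f i j))
    ≡⟨ cong₂ _+_ (sym (sumFrom-*ˡ b k (u a) _)) (sumFrom-interchange (suc a) n b k u w f) ⟩
  sumFrom b k (λ j → u a * (w j * f a j)) + sumFrom b k (λ j → w j * sumFrom (suc a) n (λ i → u i * f i j))
    ≡⟨ sym (sumFrom-+ b k _ _) ⟩
  sumFrom b k (λ j → u a * (w j * f a j) + w j * sumFrom (suc a) n (λ i → u i * f i j))
    ≡⟨ sumFrom-cong b k (λ j → factor (u a) (w j) (f a j) _) ⟩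
  sumFrom b k (λ j → w j * sumFrom a (suc n) (λ i → u i * f i j)) ∎
  where
  factor : ∀ x y z s → x * (y * z) + y * s ≡ y * (x * z + s)
  factor = solve-∀

∇ : (ℕ → ℤ) → ℕ → ℤ
∇ e zero    = e 0
∇ e (suc v) = e (suc v) - e v

sumFrom-by-parts : ∀ n (e y : ℕ → ℤ) →
  sumFrom 0 (suc n) (λ v → ∇ e v * y v) ≡ sumFrom 0 n (λ v → e v * (y v - y (suc v))) + e n * y n
sumFrom-by-parts zero    e y = trans (ℤP.+-identityʳ (e 0 * y 0)) (sym (ℤP.+-identityˡ (e 0 * y 0)))
sumFrom-by-parts (suc n) e y = begin
  sumFrom 0 (suc (suc n)) (λ v → ∇ e v * y v)
    ≡⟨ sumFrom-snoc 0 (suc n) (λ v → ∇ e v * y v) ⟩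
  sumFrom 0 (suc n) (λ v → ∇ e v * y v) + (e (suc n) - e n) * y (suc n)
    ≡⟨ cong (_+ (e (suc n) - e n) * y (suc n)) (sumFrom-by-parts n e y) ⟩
  S + e n * y n + (e (suc n) - e n) * y (suc n)
    ≡⟨ regroup S (e n) (e (suc n)) (y n) (y (suc n)) ⟩
  S + e n * (y n - y (suc n)) + e (suc n) * y (suc n)
    ≡⟨ cong (_+ e (suc n) * y (suc n)) (sumFrom-snoc 0 n (λ v → e v * (y v - y (suc v)))) ⟨
  sumFrom 0 (suc n) (λ v → e v * (y v - y (suc v))) + e (suc n) * y (suc n) ∎
  where
  S = sumFrom 0 n (λ v → e v * (y v - y (suc v)))
  regroup : ∀ s a b u w → s + a * u + (b - a) * w ≡ s + a * (u - w) + b * w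
  regroup = solve-∀

-- Binomial coefficients

sgn*sgn≡1 : ∀ a → sgn a * sgn a ≡ 1ℤ
sgn*sgn≡1 zero    = refl
sgn*sgn≡1 (suc a) = trans (negate² (sgn a)) (sgn*sgn≡1 a)
  where
  negate² : ∀ x → - 1ℤ * x * (- 1ℤ * x) ≡ x * x
  negate² = solve-∀

pow-0 : ∀ m → pow 0 m ≡ δ0 m
pow-0 zero    = refl
pow-0 (suc m) = refl

pow-suc : ∀ a e → pow a (suc e) ≡ + a * pow a e
pow-suc a e = ℤP.pos-* a (a ℕ.^ e)

sumFrom-pascal : ∀ N k (h : ℕ → ℤ) →
  sumFrom 0 (suc k) (λ t → + (suc N C t) * h t) ≡
  sumFrom 0 (suc k) (λ t → + (N C t) * h t) + sumFrom 0 k (λ t → + (N C t) * h (suc t))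
sumFrom-pascal N k h = begin
  h′ 0 + sumFrom 1 k (λ t → + (suc N C t) * h t)
    ≡⟨ cong (_+_ (h′ 0)) (trans (sumFrom-suc 0 k _) (trans (sumFrom-cong 0 k split) (sumFrom-+ 0 k _ _))) ⟩
  h′ 0 + (A + B)  ≡⟨ rearrange (h′ 0) A B ⟩
  (h′ 0 + B) + A  ≡⟨ cong (λ z → (h′ 0 + z) + A) (sym (sumFrom-suc 0 k _)) ⟩
  (h′ 0 + sumFrom 1 k (λ t → + (N C t) * h t)) + A ∎
  where
  h′ : ℕ → ℤ
  h′ t = + (N C t) * h t
  A = sumFrom 0 k (λ t → + (N C t) * h (suc t))
  B = sumFrom 0 k (λ t → + (N C suc t) * h (suc t))
  split : ∀ t → + (suc N C suc t) * h (suc t) ≡ + (N C t) * h (suc t) + + (N C suc t) * h (suc t)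
  split t = begin
    + (suc N C suc t) * h (suc t)           ≡⟨ cong (λ c → + c * h (suc t)) (nCk+nC[k+1]≡[n+1]C[k+1] N t) ⟨
    + (N C t ℕ.+ N C suc t) * h (suc t)     ≡⟨ cong (_* h (suc t)) (ℤP.pos-+ (N C t) _) ⟩
    (+ (N C t) + + (N C suc t)) * h (suc t) ≡⟨ ℤP.*-distribʳ-+ (h (suc t)) (+ (N C t)) (+ (N C suc t)) ⟩
    + (N C t) * h (suc t) + + (N C suc t) * h (suc t) ∎
  rearrange : ∀ x a b → x + (a + b) ≡ (x + b) + a
  rearrange = solve-∀

sumFrom-pascal-full : ∀ N (h : ℕ → ℤ) →
  sumFrom 0 (suc (suc N)) (λ t → + (suc N C t) * h t) ≡
  sumFrom 0 (suc N) (λ t → + (N C t) * (h t + h (suc t)))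
sumFrom-pascal-full N h = begin
  sumFrom 0 (suc (suc N)) (λ t → + (suc N C t) * h t)
    ≡⟨ sumFrom-pascal N (suc N) h ⟩
  sumFrom 0 (suc (suc N)) h′ + sumFrom 0 (suc N) (λ t → + (N C t) * h (suc t))
    ≡⟨ cong (_+ sumFrom 0 (suc N) (λ t → + (N C t) * h (suc t)))
            (trans (sumFrom-snoc 0 (suc N) h′) dropTop) ⟩
  sumFrom 0 (suc N) h′ + sumFrom 0 (suc N) (λ t → + (N C t) * h (suc t))
    ≡⟨ sumFrom-+ 0 (suc N) h′ _ ⟨
  sumFrom 0 (suc N) (λ t → h′ t + + (N C t) * h (suc t))
    ≡⟨ sumFrom-cong 0 (suc N) (λ t → sym (ℤP.*-distribˡ-+ (+ (N C t)) (h t) _)) ⟩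
  sumFrom 0 (suc N) (λ t → + (N C t) * (h t + h (suc t))) ∎
  where
  h′ : ℕ → ℤ
  h′ t = + (N C t) * h t
  dropTop : sumFrom 0 (suc N) h′ + h′ (suc N) ≡ sumFrom 0 (suc N) h′
  dropTop = trans (cong (λ c → sumFrom 0 (suc N) h′ + + c * h (suc N)) (k>n⇒nCk≡0 (ℕP.n<1+n N)))
                  (ℤP.+-identityʳ _)

binomial : ∀ a b m → pow (a ℕ.+ b) m ≡ Σ[ 0 ⋯ m ] (λ s → + (m C s) * pow a (m ℕ.∸ s) * pow b s)
binomial a b zero    = refl
binomial a b (suc m) = sym (begin
  sumFrom 0 (suc (suc m)) (λ s → + (suc m C s) * pow a (suc m ℕ.∸ s) * pow b s)
    ≡⟨ sumFrom-cong 0 (suc (suc m)) (λ s → ℤP.*-assoc (+ (suc m C s)) (pow a (suc m ℕ.∸ s)) (pow b s))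
    ⟩
  sumFrom 0 (suc (suc m)) (λ s → + (suc m C s) * h s)
    ≡⟨ sumFrom-pascal-full m h ⟩
  sumFrom 0 (suc m) (λ s → + (m C s) * (h s + h (suc s)))
    ≡⟨ sumFrom-cong-< 0 (suc m) (λ s _ s<1+m → term s (ℕP.≤-pred s<1+m)) ⟩
  sumFrom 0 (suc m) (λ s → (+ a + + b) * (+ (m C s) * pow a (m ℕ.∸ s) * pow b s))
    ≡⟨ sumFrom-*ˡ 0 (suc m) (+ a + + b) _ ⟩
  (+ a + + b) * Σ[ 0 ⋯ m ] (λ s → + (m C s) * pow a (m ℕ.∸ s) * pow b s)
    ≡⟨ cong (_*_ (+ a + + b)) (binomial a b m) ⟨
  (+ a + + b) * pow (a ℕ.+ b) m
    ≡⟨ cong (_* pow (a ℕ.+ b) m) (ℤP.pos-+ a b) ⟨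
  + (a ℕ.+ b) * pow (a ℕ.+ b) m
    ≡⟨ pow-suc (a ℕ.+ b) m ⟨
  pow (a ℕ.+ b) (suc m) ∎)
  where
  h : ℕ → ℤ
  h s = pow a (suc m ℕ.∸ s) * pow b s
  distrib : ∀ c x y p q → c * (x * p * q + p * (y * q)) ≡ (x + y) * (c * p * q)
  distrib = solve-∀
  term : ∀ s → s ≤ m →
         + (m C s) * (h s + h (suc s)) ≡ (+ a + + b) * (+ (m C s) * pow a (m ℕ.∸ s) * pow b s)
  term s s≤m = begin
    + (m C s) * (pow a (suc m ℕ.∸ s) * pow b s + h (suc s))
      ≡⟨ cong (λ e → + (m C s) * (pow a e * pow b s + h (suc s))) (ℕP.+-∸-assoc 1 s≤m) ⟩
    + (m C s) * (pow a (suc (m ℕ.∸ s)) * pow b s + pow a (m ℕ.∸ s) * pow b (suc s))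
      ≡⟨ cong₂ (λ x y → + (m C s) * (x * pow b s + pow a (m ℕ.∸ s) * y))
               (pow-suc a (m ℕ.∸ s)) (pow-suc b s) ⟩
    + (m C s) * (+ a * pow a (m ℕ.∸ s) * pow b s + pow a (m ℕ.∸ s) * (+ b * pow b s))
      ≡⟨ distrib (+ (m C s)) (+ a) (+ b) (pow a (m ℕ.∸ s)) (pow b s) ⟩
    (+ a + + b) * (+ (m C s) * pow a (m ℕ.∸ s) * pow b s) ∎

-- Sequences with the Fibonacci recurrence

fwd-rec : ∀ a b n → fwd a b (suc (suc n)) ≡ fwd a b (suc n) + fwd a b n
fwd-rec a b zero    = ℤP.+-comm a b
fwd-rec a b (suc n) = fwd-rec b (a + b) n

bwd-rec : ∀ a b n → bwd a b n ≡ bwd a b (suc n) + bwd a b (suc (suc n))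
bwd-rec a b zero    = unfold a b
  where
  unfold : ∀ a b → a ≡ (b - a) + (a - (b - a))
  unfold = solve-∀
bwd-rec a b (suc n) = bwd-rec (b - a) a n

seqℤ-rec : ∀ a b k → seqℤ a b (k + + 2) ≡ seqℤ a b (k + 1ℤ) + seqℤ a b k
seqℤ-rec a b (+ n) = begin
  fwd a b (n ℕ.+ 2)              ≡⟨ cong (fwd a b) (ℕP.+-comm n 2) ⟩
  fwd a b (suc (suc n))          ≡⟨ fwd-rec a b n ⟩
  fwd a b (suc n) + fwd a b n    ≡⟨ cong (λ k → fwd a b k + fwd a b n) (ℕP.+-comm 1 n) ⟩
  fwd a b (n ℕ.+ 1) + fwd a b n  ∎
seqℤ-rec a b -[1+ zero ]        = unfold a b
  where
  unfold : ∀ a b → b ≡ a + (b - a)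
  unfold = solve-∀
seqℤ-rec a b -[1+ suc zero ]    = bwd-rec a b 0
seqℤ-rec a b -[1+ suc (suc n) ] = bwd-rec a b (suc n)

-- Eulerian transforms and polynomial degree

-- euler N g v is the coefficient of x^v in (1 - x)^(N + 1) Σ_k g(k) x^k, so that the Eulerian number
-- A(s, j) = Eul s j is euler s (λ x → pow x s) j.
euler : ℕ → (ℕ → ℤ) → ℕ → ℤ
euler N g v = Σ[ 0 ⋯ v ] (λ t → sgn t * + (suc N C t) * g (v ℕ.∸ t))

Δ : (ℕ → ℤ) → ℕ → ℤ
Δ g x = g (suc x) - g x

euler-cong : ∀ N v {g h : ℕ → ℤ} → (∀ x → g x ≡ h x) → euler N g v ≡ euler N h v
euler-cong N v g≗h = sumFrom-cong 0 (suc v) λ t → cong (_*_ (sgn t * + (suc N C t))) (g≗h (v ℕ.∸ t))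

euler-at-0 : ∀ N (g : ℕ → ℤ) → euler N g 0 ≡ g 0
euler-at-0 N g = unit (g 0)
  where
  unit : ∀ x → 1ℤ * 1ℤ * x + 0ℤ ≡ x
  unit = solve-∀

euler-const-0 : ∀ N v → euler N (λ _ → 0ℤ) v ≡ 0ℤ
euler-const-0 N v = sumFrom-zero 0 (suc v) λ t _ _ → ℤP.*-zeroʳ (sgn t * + (suc N C t))

euler-lincomb : ∀ N v a k (c : ℕ → ℤ) (h : ℕ → ℕ → ℤ) →
  euler N (λ x → sumFrom a k (λ j → c j * h j x)) v ≡ sumFrom a k (λ j → c j * euler N (h j) v)
euler-lincomb N v a k c h =
  sumFrom-interchange 0 (suc v) a k (λ t → sgn t * + (suc N C t)) c (λ t j → h j (v ℕ.∸ t))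

euler-- : ∀ N v (g h : ℕ → ℤ) → euler N (λ x → g x - h x) v ≡ euler N g v - euler N h v
euler-- N v g h =
  trans (sumFrom-cong 0 (suc v) λ t → distrib (sgn t * + (suc N C t)) (g (v ℕ.∸ t)) (h (v ℕ.∸ t)))
        (sumFrom-- 0 (suc v) (λ t → sgn t * + (suc N C t) * g (v ℕ.∸ t))
                             (λ t → sgn t * + (suc N C t) * h (v ℕ.∸ t)))
  where
  distrib : ∀ c x y → c * (x - y) ≡ c * x - c * y
  distrib = solve-∀

euler-pascal : ∀ N (g : ℕ → ℤ) v → euler (suc N) g (suc v) ≡ euler N g (suc v) - euler N g v
euler-pascal N g v = begin
  euler (suc N) g (suc v)
    ≡⟨ sumFrom-cong 0 (suc (suc v)) (λ t → moveSign (sgn t) (+ (suc (suc N) C t)) (g (suc v ℕ.∸ t))) ⟩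
  sumFrom 0 (suc (suc v)) (λ t → + (suc (suc N) C t) * h t)
    ≡⟨ sumFrom-pascal (suc N) (suc v) h ⟩
  sumFrom 0 (suc (suc v)) (λ t → + (suc N C t) * h t)
    + sumFrom 0 (suc v) (λ t → + (suc N C t) * h (suc t))
    ≡⟨ cong₂ _+_ (sumFrom-cong 0 (suc (suc v)) λ t →
                    sym (moveSign (sgn t) (+ (suc N C t)) (g (suc v ℕ.∸ t))))
                 (trans (sumFrom-cong 0 (suc v) λ t → pullNeg (sgn t) (+ (suc N C t)) (g (v ℕ.∸ t)))
                        (sumFrom-*ˡ 0 (suc v) (- 1ℤ) (λ t → sgn t * + (suc N C t) * g (v ℕ.∸ t)))) ⟩
  euler N g (suc v) + - 1ℤ * euler N g v
    ≡⟨ minus (euler N g (suc v)) (euler N g v) ⟩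
  euler N g (suc v) - euler N g v ∎
  where
  h : ℕ → ℤ
  h t = sgn t * g (suc v ℕ.∸ t)
  moveSign : ∀ s c x → s * c * x ≡ c * (s * x)
  moveSign = solve-∀
  pullNeg : ∀ s c x → c * (- 1ℤ * s * x) ≡ - 1ℤ * (s * c * x)
  pullNeg = solve-∀
  minus : ∀ a b → a + - 1ℤ * b ≡ a - b
  minus = solve-∀

euler-∇ : ∀ N (g : ℕ → ℤ) v → euler (suc N) g v ≡ ∇ (euler N g) v
euler-∇ N g zero    = trans (euler-at-0 (suc N) g) (sym (euler-at-0 N g))
euler-∇ N g (suc v) = euler-pascal N g v

euler-suc : ∀ N (g : ℕ → ℤ) v →
  euler N g (suc v) ≡ euler N (λ x → g (suc x)) v + sgn (suc v) * + (suc N C suc v) * g 0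
euler-suc N g v = begin
  euler N g (suc v)
    ≡⟨ sumFrom-snoc 0 (suc v) (λ t → sgn t * + (suc N C t) * g (suc v ℕ.∸ t)) ⟩
  sumFrom 0 (suc v) (λ t → sgn t * + (suc N C t) * g (suc v ℕ.∸ t))
    + sgn (suc v) * + (suc N C suc v) * g (v ℕ.∸ v)
    ≡⟨ cong₂ _+_ (sumFrom-cong-< 0 (suc v) λ t _ t<1+v →
                    cong (λ e → sgn t * + (suc N C t) * g e) (ℕP.+-∸-assoc 1 (ℕP.≤-pred t<1+v)))
                 (cong (λ e → sgn (suc v) * + (suc N C suc v) * g e) (ℕP.n∸n≡0 v)) ⟩
  euler N (λ x → g (suc x)) v + sgn (suc v) * + (suc N C suc v) * g 0 ∎

euler-Δ : ∀ N (g : ℕ → ℤ) → euler (suc N) g (suc (suc N)) ≡ euler N (Δ g) (suc N)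
euler-Δ N g = begin
  euler (suc N) g (suc (suc N))
    ≡⟨ euler-pascal N g (suc N) ⟩
  euler N g (suc (suc N)) - euler N g (suc N)
    ≡⟨ cong (_- euler N g (suc N)) (euler-suc N g (suc N)) ⟩
  G + sgn (suc (suc N)) * + (suc N C suc (suc N)) * g 0 - euler N g (suc N)
    ≡⟨ cong (λ c → G + sgn (suc (suc N)) * + c * g 0 - euler N g (suc N))
            (k>n⇒nCk≡0 (ℕP.n<1+n (suc N))) ⟩
  G + sgn (suc (suc N)) * 0ℤ * g 0 - euler N g (suc N)
    ≡⟨ dropZero G (sgn (suc (suc N))) (g 0) (euler N g (suc N)) ⟩
  G - euler N g (suc N)
    ≡⟨ euler-- N (suc N) (λ x → g (suc x)) g ⟨
  euler N (Δ g) (suc N) ∎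
  where
  G = euler N (λ x → g (suc x)) (suc N)
  dropZero : ∀ a s x b → a + s * 0ℤ * x - b ≡ a - b
  dropZero = solve-∀

-- euler N g (N + 1) is the (N + 1)-st forward difference of g at 0, so by Newton's
-- interpolation formula this says that g is a polynomial of degree at most d.
HasDegree≤ : ℕ → (ℕ → ℤ) → Set
HasDegree≤ d g = ∀ N → d ≤ N → euler N g (suc N) ≡ 0ℤ

degree-cong : ∀ {d} {g h : ℕ → ℤ} → (∀ x → g x ≡ h x) → HasDegree≤ d g → HasDegree≤ d h
degree-cong g≗h deg-g N d≤N = trans (sym (euler-cong N (suc N) g≗h)) (deg-g N d≤N)

degree-mono : ∀ {d e} {g : ℕ → ℤ} → d ≤ e → HasDegree≤ d g → HasDegree≤ e g
degree-mono d≤e deg-g N e≤N = deg-g N (ℕP.≤-trans d≤e e≤N)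

degree-const : ∀ c → HasDegree≤ 0 (λ _ → c)
degree-const c zero    _ = cancel c
  where
  cancel : ∀ c → 1ℤ * 1ℤ * c + (- 1ℤ * 1ℤ * c + 0ℤ) ≡ 0ℤ
  cancel = solve-∀
degree-const c (suc N) _ = begin
  euler (suc N) (λ _ → c) (suc (suc N)) ≡⟨ euler-Δ N (λ _ → c) ⟩
  euler N (λ _ → c - c) (suc N)         ≡⟨ euler-cong N (suc N) (λ _ → ℤP.+-inverseʳ c) ⟩
  euler N (λ _ → 0ℤ) (suc N)            ≡⟨ euler-const-0 N (suc N) ⟩
  0ℤ ∎

degree-Δ : ∀ {d} {g : ℕ → ℤ} → HasDegree≤ d (Δ g) → HasDegree≤ (suc d) g
degree-Δ {g = g} deg-Δg (suc N) (s≤s d≤N) = trans (euler-Δ N g) (deg-Δg N d≤N)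

degree-lincomb : ∀ {d} a k (c : ℕ → ℤ) (h : ℕ → ℕ → ℤ) →
  (∀ j → a ≤ j → j < a ℕ.+ k → HasDegree≤ d (h j)) →
  HasDegree≤ d (λ x → sumFrom a k (λ j → c j * h j x))
degree-lincomb a k c h deg-h N d≤N =
  trans (euler-lincomb N (suc N) a k c h)
        (sumFrom-zero a k λ j a≤j j<a+k →
          trans (cong (_*_ (c j)) (deg-h j a≤j j<a+k N d≤N)) (ℤP.*-zeroʳ (c j)))

Δ-pow : ∀ n m x →
  Δ (λ y → pow (n ℕ.+ y) (suc m)) x ≡ Σ[ 0 ⋯ m ] (λ j → + (suc m C j) * pow (n ℕ.+ x) j)
Δ-pow n m x = begin
  pow (n ℕ.+ suc x) (suc m) - pow y (suc m)
    ≡⟨ cong (λ z → pow z (suc m) - pow y (suc m)) (ℕP.+-suc n x) ⟩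
  pow (1 ℕ.+ y) (suc m) - pow y (suc m)
    ≡⟨ cong (_- pow y (suc m)) (binomial 1 y (suc m)) ⟩
  sumFrom 0 (suc (suc m)) (λ j → + (suc m C j) * pow 1 (suc m ℕ.∸ j) * pow y j) - pow y (suc m)
    ≡⟨ cong (_- pow y (suc m)) (sumFrom-cong 0 (suc (suc m)) λ j →
         cong (λ p → + (suc m C j) * + p * pow y j) (ℕP.^-zeroˡ (suc m ℕ.∸ j))) ⟩
  sumFrom 0 (suc (suc m)) (λ j → + (suc m C j) * + 1 * pow y j) - pow y (suc m)
    ≡⟨ cong (_- pow y (suc m)) (sumFrom-snoc 0 (suc m) (λ j → + (suc m C j) * + 1 * pow y j)) ⟩
  S + + (suc m C suc m) * + 1 * pow y (suc m) - pow y (suc m)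
    ≡⟨ cong (λ c → S + + c * + 1 * pow y (suc m) - pow y (suc m)) (nCn≡1 (suc m)) ⟩
  S + + 1 * + 1 * pow y (suc m) - pow y (suc m)
    ≡⟨ cancel S (pow y (suc m)) ⟩
  S
    ≡⟨ sumFrom-cong 0 (suc m) (λ j → cong (_* pow y j) (ℤP.*-identityʳ (+ (suc m C j)))) ⟩
  Σ[ 0 ⋯ m ] (λ j → + (suc m C j) * pow y j) ∎
  where
  y = n ℕ.+ x
  S = sumFrom 0 (suc m) (λ j → + (suc m C j) * + 1 * pow y j)
  cancel : ∀ s p → s + + 1 * + 1 * p - p ≡ s
  cancel = solve-∀

pow-degree≤ : ∀ d n i → i ≤ d → HasDegree≤ d (λ x → pow (n ℕ.+ x) i)
pow-degree≤ zero    n zero    z≤n       = degree-const (+ 1)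
pow-degree≤ (suc d) n zero    z≤n       = degree-mono {g = λ _ → + 1} z≤n (degree-const (+ 1))
pow-degree≤ (suc d) n (suc i) (s≤s i≤d) =
  degree-Δ {g = λ x → pow (n ℕ.+ x) (suc i)} (degree-cong (λ x → sym (Δ-pow n i x))
    (degree-lincomb 0 (suc i) (λ j → + (suc i C j)) (λ j x → pow (n ℕ.+ x) j) λ j _ j<1+i →
      pow-degree≤ d n j (ℕP.≤-trans (ℕP.≤-pred j<1+i) i≤d)))

pow-degree : ∀ n m → HasDegree≤ m (λ x → pow (n ℕ.+ x) m)
pow-degree n m = pow-degree≤ m n m ℕP.≤-refl

-- Sums against a sequence with the Fibonacci recurrence

module FibonacciLike (X : ℤ → ℤ) (X-rec : ∀ k → X (k + + 2) ≡ X (k + 1ℤ) + X k) where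

  alternating-binomial : ∀ M q →
    Σ[ 0 ⋯ M ] (λ t → sgn t * + (M C t) * X (q + + t)) ≡ sgn M * X (q - + M)
  alternating-binomial zero    q =
    trans (unit (X (q + + 0))) (cong (λ p → 1ℤ * X p) (plus0≡minus0 q))
    where
    unit : ∀ x → 1ℤ * 1ℤ * x + 0ℤ ≡ 1ℤ * x
    unit = solve-∀
    plus0≡minus0 : ∀ q → q + + 0 ≡ q - + 0
    plus0≡minus0 = solve-∀
  alternating-binomial (suc M) q = begin
    sumFrom 0 (suc (suc M)) (λ t → sgn t * + (suc M C t) * X (q + + t))
      ≡⟨ sumFrom-cong 0 (suc (suc M)) (λ t → moveSign (sgn t) (+ (suc M C t)) (X (q + + t))) ⟩
    sumFrom 0 (suc (suc M)) (λ t → + (suc M C t) * h t)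
      ≡⟨ sumFrom-pascal-full M h ⟩
    sumFrom 0 (suc M) (λ t → + (M C t) * (h t + h (suc t)))
      ≡⟨ sumFrom-cong 0 (suc M) (λ t → cong (_*_ (+ (M C t))) (adjacent t)) ⟩
    sumFrom 0 (suc M) (λ t → + (M C t) * (- 1ℤ * (sgn t * X (q - 1ℤ + + t))))
      ≡⟨ sumFrom-cong 0 (suc M) (λ t → pullNeg (+ (M C t)) (sgn t) (X (q - 1ℤ + + t))) ⟩
    sumFrom 0 (suc M) (λ t → - 1ℤ * (sgn t * + (M C t) * X (q - 1ℤ + + t)))
      ≡⟨ sumFrom-*ˡ 0 (suc M) (- 1ℤ) (λ t → sgn t * + (M C t) * X (q - 1ℤ + + t)) ⟩
    - 1ℤ * sumFrom 0 (suc M) (λ t → sgn t * + (M C t) * X (q - 1ℤ + + t))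
      ≡⟨ cong (_*_ (- 1ℤ)) (alternating-binomial M (q - 1ℤ)) ⟩
    - 1ℤ * (sgn M * X (q - 1ℤ - + M))
      ≡⟨ trans (sym (ℤP.*-assoc (- 1ℤ) (sgn M) _))
               (cong (λ p → sgn (suc M) * X p) (reindex q (+ M))) ⟩
    sgn (suc M) * X (q - + suc M) ∎
    where
    h : ℕ → ℤ
    h t = sgn t * X (q + + t)
    moveSign : ∀ s c x → s * c * x ≡ c * (s * x)
    moveSign = solve-∀
    pullNeg : ∀ c s x → c * (- 1ℤ * (s * x)) ≡ - 1ℤ * (s * c * x)
    pullNeg = solve-∀
    reindex : ∀ q m → q - 1ℤ - m ≡ q - (1ℤ + m)
    reindex = solve-∀
    shift₁ : ∀ q t → q + t ≡ q - 1ℤ + t + 1ℤ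
    shift₁ = solve-∀
    shift₂ : ∀ q t → q + (1ℤ + t) ≡ q - 1ℤ + t + + 2
    shift₂ = solve-∀
    difference : ∀ s a b c → b ≡ a + c → s * a + - 1ℤ * s * b ≡ - 1ℤ * (s * c)
    difference s a b c refl = expand s a c
      where
      expand : ∀ s a c → s * a + - 1ℤ * s * (a + c) ≡ - 1ℤ * (s * c)
      expand = solve-∀
    adjacent : ∀ t → h t + h (suc t) ≡ - 1ℤ * (sgn t * X (q - 1ℤ + + t))
    adjacent t =
      trans (cong₂ (λ a b → sgn t * X a + - 1ℤ * sgn t * X b) (shift₁ q (+ t)) (shift₂ q (+ t)))
            (difference (sgn t) _ _ _ (X-rec (q - 1ℤ + + t)))

  -- For g of degree ≤ N, sgn (N + 1) * Λ N g q is the finite value of Σ_{k ≥ 0} g(k) X(k + q).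
  Λ : ℕ → (ℕ → ℤ) → ℤ → ℤ
  Λ N g q = Σ[ 0 ⋯ N ] (λ v → euler N g v * X (+ (v ℕ.+ N ℕ.+ 1) + q))

  Λ-cong : ∀ N q {g h : ℕ → ℤ} → (∀ x → g x ≡ h x) → Λ N g q ≡ Λ N h q
  Λ-cong N q g≗h =
    sumFrom-cong 0 (suc N) λ v → cong (_* X (+ (v ℕ.+ N ℕ.+ 1) + q)) (euler-cong N v g≗h)

  Λ-lincomb : ∀ N q a k (c : ℕ → ℤ) (h : ℕ → ℕ → ℤ) →
    Λ N (λ x → sumFrom a k (λ j → c j * h j x)) q ≡ sumFrom a k (λ j → c j * Λ N (h j) q)
  Λ-lincomb N q a k c h = begin
    Λ N (λ x → sumFrom a k (λ j → c j * h j x)) q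
      ≡⟨ sumFrom-cong 0 (suc N) (λ v →
           trans (cong (_* Y v) (euler-lincomb N v a k c h)) (ℤP.*-comm _ (Y v))) ⟩
    sumFrom 0 (suc N) (λ v → Y v * sumFrom a k (λ j → c j * euler N (h j) v))
      ≡⟨ sumFrom-interchange 0 (suc N) a k Y c (λ v j → euler N (h j) v) ⟩
    sumFrom a k (λ j → c j * sumFrom 0 (suc N) (λ v → Y v * euler N (h j) v))
      ≡⟨ sumFrom-cong a k (λ j → cong (_*_ (c j)) (sumFrom-cong 0 (suc N) λ v → ℤP.*-comm (Y v) _)) ⟩
    sumFrom a k (λ j → c j * Λ N (h j) q) ∎
    where
    Y : ℕ → ℤ
    Y v = X (+ (v ℕ.+ N ℕ.+ 1) + q)

  Λ-suc : ∀ N q (g : ℕ → ℤ) → euler N g (suc N) ≡ 0ℤ → Λ (suc N) g q ≡ - Λ N g q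
  Λ-suc N q g vanish = begin
    Λ (suc N) g q
      ≡⟨ sumFrom-cong 0 (suc (suc N)) (λ v → cong (_* Y v) (euler-∇ N g v)) ⟩
    sumFrom 0 (suc (suc N)) (λ v → ∇ (euler N g) v * Y v)
      ≡⟨ sumFrom-by-parts (suc N) (euler N g) Y ⟩
    sumFrom 0 (suc N) (λ v → euler N g v * (Y v - Y (suc v))) + euler N g (suc N) * Y (suc N)
      ≡⟨ cong₂ _+_ (sumFrom-cong 0 (suc N) λ v → cong (_*_ (euler N g v)) (step v))
                   (trans (cong (_* Y (suc N)) vanish) (ℤP.*-zeroˡ (Y (suc N)))) ⟩
    sumFrom 0 (suc N) (λ v → euler N g v * - X (+ (v ℕ.+ N ℕ.+ 1) + q)) + 0ℤ
      ≡⟨ ℤP.+-identityʳ _ ⟩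
    sumFrom 0 (suc N) (λ v → euler N g v * - X (+ (v ℕ.+ N ℕ.+ 1) + q))
      ≡⟨ sumFrom-cong 0 (suc N) (λ v → pullNeg (euler N g v) (X (+ (v ℕ.+ N ℕ.+ 1) + q))) ⟩
    sumFrom 0 (suc N) (λ v → - 1ℤ * (euler N g v * X (+ (v ℕ.+ N ℕ.+ 1) + q)))
      ≡⟨ sumFrom-*ˡ 0 (suc N) (- 1ℤ) (λ v → euler N g v * X (+ (v ℕ.+ N ℕ.+ 1) + q)) ⟩
    - 1ℤ * Λ N g q
      ≡⟨ ℤP.-1*i≡-i (Λ N g q) ⟩
    - Λ N g q ∎
    where
    Y : ℕ → ℤ
    Y v = X (+ (v ℕ.+ suc N ℕ.+ 1) + q)
    pullNeg : ∀ e x → e * - x ≡ - 1ℤ * (e * x)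
    pullNeg = solve-∀
    shift₁ : ∀ v n q → v + (1ℤ + n) + 1ℤ + q ≡ v + n + 1ℤ + q + 1ℤ
    shift₁ = solve-∀
    shift₂ : ∀ v n q → 1ℤ + v + (1ℤ + n) + 1ℤ + q ≡ v + n + 1ℤ + q + + 2
    shift₂ = solve-∀
    cancel : ∀ a b → a - (a + b) ≡ - b
    cancel = solve-∀
    step : ∀ v → Y v - Y (suc v) ≡ - X (+ (v ℕ.+ N ℕ.+ 1) + q)
    step v = begin
      Y v - Y (suc v)
        ≡⟨ cong₂ (λ a b → X a - X b) (shift₁ (+ v) (+ N) q) (shift₂ (+ v) (+ N) q) ⟩
      X (b + 1ℤ) - X (b + + 2)      ≡⟨ cong (_-_ (X (b + 1ℤ))) (X-rec b) ⟩
      X (b + 1ℤ) - (X (b + 1ℤ) + X b) ≡⟨ cancel (X (b + 1ℤ)) (X b) ⟩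
      - X b ∎
      where
      b = + (v ℕ.+ N ℕ.+ 1) + q

  Λ-stable : ∀ {d} {g : ℕ → ℤ} → HasDegree≤ d g →
             ∀ {N} q → d ≤ N → sgn N * Λ N g q ≡ sgn d * Λ d g q
  Λ-stable {d} {g} deg q d≤N = go (ℕP.≤⇒≤′ d≤N)
    where
    flip : ∀ s l → - 1ℤ * s * - l ≡ s * l
    flip = solve-∀
    go : ∀ {N} → d ℕ.≤′ N → sgn N * Λ N g q ≡ sgn d * Λ d g q
    go ℕ.≤′-refl             = refl
    go (ℕ.≤′-step {N} d≤′N) = begin
      sgn (suc N) * Λ (suc N) g q
        ≡⟨ cong (_*_ (sgn (suc N))) (Λ-suc N q g (deg N (ℕP.≤′⇒≤ d≤′N))) ⟩
      - 1ℤ * sgn N * - Λ N g q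
        ≡⟨ flip (sgn N) (Λ N g q) ⟩
      sgn N * Λ N g q
        ≡⟨ go d≤′N ⟩
      sgn d * Λ d g q ∎

  Λ-shift : ∀ N q (g : ℕ → ℤ) → euler N g (suc N) ≡ 0ℤ →
    Λ N (λ x → g (suc x)) (q + 1ℤ) ≡ Λ N g q + sgn N * g 0 * X q
  Λ-shift N q g vanish = begin
    Λ N (λ x → g (suc x)) (q + 1ℤ)
      ≡⟨ sumFrom-cong 0 (suc N) term ⟩
    sumFrom 0 (suc N) (λ v → E (suc v) * Z (suc v) - g 0 * (c (suc v) * Z (suc v)))
      ≡⟨ sumFrom-- 0 (suc N) (λ v → E (suc v) * Z (suc v)) (λ v → g 0 * (c (suc v) * Z (suc v))) ⟩
    A - sumFrom 0 (suc N) (λ v → g 0 * (c (suc v) * Z (suc v)))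
      ≡⟨ cong (_-_ A) (sumFrom-*ˡ 0 (suc N) (g 0) (λ v → c (suc v) * Z (suc v))) ⟩
    A - g 0 * B
      ≡⟨ cong₂ (λ a b → a - g 0 * b) (peel (g 0 * Z 0) A tailE) (peel (Z 0) B tailC) ⟩
    (Λ N g q - g 0 * Z 0) - g 0 * (sgn (suc N) * X q - Z 0)
      ≡⟨ simplify (Λ N g q) (g 0) (Z 0) (sgn N) (X q) ⟩
    Λ N g q + sgn N * g 0 * X q ∎
    where
    E : ℕ → ℤ
    E = euler N g
    c : ℕ → ℤ
    c t = sgn t * + (suc N C t)
    Z : ℕ → ℤ
    Z u = X (+ (u ℕ.+ N ℕ.+ 1) + q)
    A = sumFrom 0 (suc N) (λ v → E (suc v) * Z (suc v))
    B = sumFrom 0 (suc N) (λ v → c (suc v) * Z (suc v))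
    peel : ∀ x a {l} → x + a ≡ l → a ≡ l - x
    peel x a refl = cancel x a
      where
      cancel : ∀ x a → a ≡ x + a - x
      cancel = solve-∀
    reindex : ∀ v n q → v + n + 1ℤ + (q + 1ℤ) ≡ 1ℤ + v + n + 1ℤ + q
    reindex = solve-∀
    expand : ∀ a b g z → (a - b * g) * z ≡ a * z - g * (b * z)
    expand = solve-∀
    term : ∀ v → euler N (λ x → g (suc x)) v * X (+ (v ℕ.+ N ℕ.+ 1) + (q + 1ℤ))
               ≡ E (suc v) * Z (suc v) - g 0 * (c (suc v) * Z (suc v))
    term v = begin
      euler N (λ x → g (suc x)) v * X (+ (v ℕ.+ N ℕ.+ 1) + (q + 1ℤ))
        ≡⟨ cong₂ _*_ (peel (c (suc v) * g 0) G (trans (ℤP.+-comm _ G) (sym (euler-suc N g v))))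
                     (cong X (reindex (+ v) (+ N) q)) ⟩
      (E (suc v) - c (suc v) * g 0) * Z (suc v)
        ≡⟨ expand (E (suc v)) (c (suc v)) (g 0) (Z (suc v)) ⟩
      E (suc v) * Z (suc v) - g 0 * (c (suc v) * Z (suc v)) ∎
      where
      G = euler N (λ x → g (suc x)) v
    tailE : g 0 * Z 0 + A ≡ Λ N g q
    tailE = begin
      g 0 * Z 0 + A
        ≡⟨ cong₂ _+_ (cong (_* Z 0) (sym (euler-at-0 N g)))
                     (sym (sumFrom-suc 0 (suc N) (λ v → E v * Z v))) ⟩
      sumFrom 0 (suc (suc N)) (λ v → E v * Z v)
        ≡⟨ sumFrom-snoc 0 (suc N) (λ v → E v * Z v) ⟩
      Λ N g q + E (suc N) * Z (suc N)
        ≡⟨ cong (λ e → Λ N g q + e * Z (suc N)) vanish ⟩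
      Λ N g q + 0ℤ * Z (suc N)
        ≡⟨ trans (cong (_+_ (Λ N g q)) (ℤP.*-zeroˡ (Z (suc N)))) (ℤP.+-identityʳ (Λ N g q)) ⟩
      Λ N g q ∎
    shiftBase : ∀ t n q → t + n + 1ℤ + q ≡ n + 1ℤ + q + t
    shiftBase = solve-∀
    unshift : ∀ n q → n + 1ℤ + q - (1ℤ + n) ≡ q
    unshift = solve-∀
    tailC : Z 0 + B ≡ sgn (suc N) * X q
    tailC = begin
      Z 0 + B
        ≡⟨ cong₂ _+_ (sym (ℤP.*-identityˡ (Z 0))) (sym (sumFrom-suc 0 (suc N) (λ t → c t * Z t))) ⟩
      sumFrom 0 (suc (suc N)) (λ t → c t * Z t)
        ≡⟨ sumFrom-cong 0 (suc (suc N)) (λ t → cong (λ i → c t * X i) (shiftBase (+ t) (+ N) q)) ⟩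
      sumFrom 0 (suc (suc N)) (λ t → c t * X (+ (N ℕ.+ 1) + q + + t))
        ≡⟨ alternating-binomial (suc N) (+ (N ℕ.+ 1) + q) ⟩
      sgn (suc N) * X (+ (N ℕ.+ 1) + q - + suc N)
        ≡⟨ cong (λ i → sgn (suc N) * X i) (unshift (+ N) q) ⟩
      sgn (suc N) * X q ∎
    simplify : ∀ l g z s x → (l - g * z) - g * (- 1ℤ * s * x - z) ≡ l + s * g * x
    simplify = solve-∀

  X-addition : ∀ k q → X (+ suc k + q) ≡ F (+ k) * X q + F (+ suc k) * X (q + 1ℤ)
  X-addition zero    q = trans (cong X (ℤP.+-comm (+ 1) q)) (unit (X (q + 1ℤ)) (X q))
    where
    unit : ∀ a b → a ≡ 0ℤ * b + 1ℤ * a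
    unit = solve-∀
  X-addition (suc k) q = begin
    X (+ suc (suc k) + q)
      ≡⟨ cong X (shift (+ k) q) ⟩
    X (+ suc k + (q + 1ℤ))
      ≡⟨ X-addition k (q + 1ℤ) ⟩
    F (+ k) * X (q + 1ℤ) + F (+ suc k) * X (q + 1ℤ + 1ℤ)
      ≡⟨ cong (λ x → F (+ k) * X (q + 1ℤ) + F (+ suc k) * x)
              (trans (cong X (ℤP.+-assoc q 1ℤ 1ℤ)) (X-rec q)) ⟩
    F (+ k) * X (q + 1ℤ) + F (+ suc k) * (X (q + 1ℤ) + X q)
      ≡⟨ regroup (F (+ k)) (F (+ suc k)) (X q) (X (q + 1ℤ)) ⟩
    F (+ suc k) * X q + (F (+ suc k) + F (+ k)) * X (q + 1ℤ)
      ≡⟨ cong (λ f → F (+ suc k) * X q + f * X (q + 1ℤ)) (sym (fwd-rec 0ℤ 1ℤ k)) ⟩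
    F (+ suc k) * X q + F (+ suc (suc k)) * X (q + 1ℤ) ∎
    where
    shift : ∀ k q → 1ℤ + (1ℤ + k) + q ≡ 1ℤ + k + (q + 1ℤ)
    shift = solve-∀
    regroup : ∀ f₀ f₁ x₀ x₁ → f₀ * x₁ + f₁ * (x₁ + x₀) ≡ f₁ * x₀ + (f₁ + f₀) * x₁
    regroup = solve-∀

  X-addition-sum : ∀ a k (e : ℕ → ℤ) (h : ℕ → ℕ) q →
    sumFrom a k (λ j → e j * F (+ h j)) * X q + sumFrom a k (λ j → e j * F (+ (h j ℕ.+ 1))) * X (q + 1ℤ)
      ≡ sumFrom a k (λ j → e j * X (+ (h j ℕ.+ 1) + q))
  X-addition-sum a k e h q = begin
    sumFrom a k (λ j → e j * F (+ h j)) * X q + sumFrom a k (λ j → e j * F (+ (h j ℕ.+ 1))) * X (q + 1ℤ)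
      ≡⟨ cong₂ _+_ (sumFrom-*ʳ a k (X q) _) (sumFrom-*ʳ a k (X (q + 1ℤ)) _) ⟨
    sumFrom a k (λ j → e j * F (+ h j) * X q) + sumFrom a k (λ j → e j * F (+ (h j ℕ.+ 1)) * X (q + 1ℤ))
      ≡⟨ sumFrom-+ a k _ _ ⟨
    sumFrom a k (λ j → e j * F (+ h j) * X q + e j * F (+ (h j ℕ.+ 1)) * X (q + 1ℤ))
      ≡⟨ sumFrom-cong a k term ⟩
    sumFrom a k (λ j → e j * X (+ (h j ℕ.+ 1) + q)) ∎
    where
    factor : ∀ e f₀ f₁ x₀ x₁ → e * f₀ * x₀ + e * f₁ * x₁ ≡ e * (f₀ * x₀ + f₁ * x₁)
    factor = solve-∀
    term : ∀ j → e j * F (+ h j) * X q + e j * F (+ (h j ℕ.+ 1)) * X (q + 1ℤ)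
               ≡ e j * X (+ (h j ℕ.+ 1) + q)
    term j = begin
      e j * F (+ h j) * X q + e j * F (+ (h j ℕ.+ 1)) * X (q + 1ℤ)
        ≡⟨ factor (e j) (F (+ h j)) (F (+ (h j ℕ.+ 1))) (X q) (X (q + 1ℤ)) ⟩
      e j * (F (+ h j) * X q + F (+ (h j ℕ.+ 1)) * X (q + 1ℤ))
        ≡⟨ cong (λ i → e j * (F (+ h j) * X q + F (+ i) * X (q + 1ℤ))) (ℕP.+-comm (h j) 1) ⟩
      e j * (F (+ h j) * X q + F (+ suc (h j)) * X (q + 1ℤ))
        ≡⟨ cong (_*_ (e j)) (X-addition (h j) q) ⟨
      e j * X (+ suc (h j) + q)
        ≡⟨ cong (λ i → e j * X (+ i + q)) (ℕP.+-comm 1 (h j)) ⟩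
      e j * X (+ (h j ℕ.+ 1) + q) ∎

  Λ-pow-via-F : ∀ s q → 1 ≤ s →
    Σ[ 1 ⋯ s ] (λ j → Eul s j * F (+ (j ℕ.+ s))) * X q
      + Σ[ 1 ⋯ s ] (λ j → Eul s j * F (+ (j ℕ.+ s ℕ.+ 1))) * X (q + 1ℤ)
      ≡ Λ s (λ x → pow x s) q
  Λ-pow-via-F (suc s) q _ =
    trans (X-addition-sum 1 (suc s) (Eul (suc s)) (λ j → j ℕ.+ suc s) q) (sym (ℤP.+-identityˡ _))

  -- The finite value of Σ_{k ≥ n} k^m X(k + r).
  tail : ℕ → ℕ → ℤ → ℤ
  tail m n r = sgn (suc m) * Λ m (λ x → pow (n ℕ.+ x) m) (+ n + r)

  tail-step : ∀ m n r → tail m n r - tail m (suc n) r ≡ pow n m * X (+ n + r)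
  tail-step m n r = begin
    T - sgn (suc m) * Λ m (λ x → pow (suc n ℕ.+ x) m) (+ suc n + r)
      ≡⟨ cong (λ l → T - sgn (suc m) * l)
              (Λ-cong m (+ suc n + r) λ x → cong (λ i → pow i m) (sym (ℕP.+-suc n x))) ⟩
    T - sgn (suc m) * Λ m (λ x → g (suc x)) (+ suc n + r)
      ≡⟨ cong (λ i → T - sgn (suc m) * Λ m (λ x → g (suc x)) i) (shift (+ n) r) ⟩
    T - sgn (suc m) * Λ m (λ x → g (suc x)) (q + 1ℤ)
      ≡⟨ cong (λ l → T - sgn (suc m) * l) (Λ-shift m q g (pow-degree n m m ℕP.≤-refl)) ⟩
    T - sgn (suc m) * (Λ m g q + sgn m * g 0 * X q)
      ≡⟨ simplify (sgn m) (Λ m g q) (g 0) (X q) ⟩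
    (sgn m * sgn m) * g 0 * X q
      ≡⟨ cong₂ (λ s p → s * p * X q) (sgn*sgn≡1 m) (cong (λ i → pow i m) (ℕP.+-identityʳ n)) ⟩
    1ℤ * pow n m * X q
      ≡⟨ cong (_* X q) (ℤP.*-identityˡ (pow n m)) ⟩
    pow n m * X q ∎
    where
    g : ℕ → ℤ
    g x = pow (n ℕ.+ x) m
    q = + n + r
    T = tail m n r
    shift : ∀ n r → 1ℤ + n + r ≡ n + r + 1ℤ
    shift = solve-∀
    simplify : ∀ s l p x → - 1ℤ * s * l - - 1ℤ * s * (l + s * p * x) ≡ (s * s) * p * x
    simplify = solve-∀

  tail-expansion : ∀ m n r →
    Σ[ 0 ⋯ m ] (λ s → sgn s * + (m C s) * pow n (m ℕ.∸ s) * Λ s (λ x → pow x s) (+ n + r))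
      ≡ - tail m n r
  tail-expansion m n r = begin
    sumFrom 0 (suc m) (λ s → sgn s * + (m C s) * pow n (m ℕ.∸ s) * Λ s (λ x → pow x s) q)
      ≡⟨ sumFrom-cong-< 0 (suc m) (λ s _ s<1+m →
           trans (moveSign (sgn s) (+ (m C s)) (pow n (m ℕ.∸ s)) (Λ s (λ x → pow x s) q))
                 (cong (_*_ (a s)) (sym (stable s (ℕP.≤-pred s<1+m))))) ⟩
    sumFrom 0 (suc m) (λ s → a s * (sgn m * Λ m (λ x → pow x s) q))
      ≡⟨ sumFrom-cong 0 (suc m) (λ s → pullSign (a s) (sgn m) (Λ m (λ x → pow x s) q)) ⟩
    sumFrom 0 (suc m) (λ s → sgn m * (a s * Λ m (λ x → pow x s) q))
      ≡⟨ sumFrom-*ˡ 0 (suc m) (sgn m) (λ s → a s * Λ m (λ x → pow x s) q) ⟩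
    sgn m * sumFrom 0 (suc m) (λ s → a s * Λ m (λ x → pow x s) q)
      ≡⟨ cong (_*_ (sgn m)) (Λ-lincomb m q 0 (suc m) a (λ s x → pow x s)) ⟨
    sgn m * Λ m (λ x → sumFrom 0 (suc m) (λ s → a s * pow x s)) q
      ≡⟨ cong (_*_ (sgn m)) (Λ-cong m q (λ x → binomial n x m)) ⟨
    sgn m * Λ m (λ x → pow (n ℕ.+ x) m) q
      ≡⟨ negate² (sgn m) (Λ m (λ x → pow (n ℕ.+ x) m) q) ⟩
    - tail m n r ∎
    where
    q = + n + r
    a : ℕ → ℤ
    a s = + (m C s) * pow n (m ℕ.∸ s)
    stable : ∀ s → s ≤ m → sgn m * Λ m (λ x → pow x s) q ≡ sgn s * Λ s (λ x → pow x s) q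
    stable s = Λ-stable {g = λ x → pow x s} (pow-degree 0 s) q
    moveSign : ∀ s c p l → s * c * p * l ≡ c * p * (s * l)
    moveSign = solve-∀
    pullSign : ∀ a s l → a * (s * l) ≡ s * (a * l)
    pullSign = solve-∀
    negate² : ∀ s l → s * l ≡ - (- 1ℤ * s * l)
    negate² = solve-∀

  P-combination : ∀ m n r → P₁ m n * X (+ n + r) + P₂ m n * X (+ n + r + + 1) ≡ - tail m (suc n) r
  P-combination m n r = begin
    (pow n m + SA) * X q + (pow n m + SB) * X (q + 1ℤ)
      ≡⟨ regroup (pow n m) SA SB (X q) (X (q + 1ℤ)) ⟩
    pow n m * X q + (pow n m * X (q + 1ℤ) + (SA * X q + SB * X (q + 1ℤ)))
      ≡⟨ cong₂ (λ a b → pow n m * X q + (a + b)) lowest higher ⟩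
    pow n m * X q + Σ[ 0 ⋯ m ] (λ s → coef s * c s)
      ≡⟨ cong (_+_ (pow n m * X q)) (tail-expansion m n r) ⟩
    pow n m * X q - tail m n r
      ≡⟨ cong (_- tail m n r) (tail-step m n r) ⟨
    tail m n r - tail m (suc n) r - tail m n r
      ≡⟨ cancel (tail m n r) (tail m (suc n) r) ⟩
    - tail m (suc n) r ∎
    where
    q = + n + r
    coef : ℕ → ℤ
    coef s = sgn s * + (m C s) * pow n (m ℕ.∸ s)
    c : ℕ → ℤ
    c s = Λ s (λ x → pow x s) q
    SA = Σ[ 1 ⋯ m ] (λ s → coef s * Σ[ 1 ⋯ s ] (λ j → Eul s j * F (+ (j ℕ.+ s))))
    SB = Σ[ 1 ⋯ m ] (λ s → coef s * Σ[ 1 ⋯ s ] (λ j → Eul s j * F (+ (j ℕ.+ s ℕ.+ 1))))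
    regroup : ∀ p a b x₀ x₁ → (p + a) * x₀ + (p + b) * x₁ ≡ p * x₀ + (p * x₁ + (a * x₀ + b * x₁))
    regroup = solve-∀
    cancel : ∀ t u → t - u - t ≡ - u
    cancel = solve-∀
    unit : ∀ p x → p * x ≡ 1ℤ * 1ℤ * p * (1ℤ * x + 0ℤ)
    unit = solve-∀
    lowest : pow n m * X (q + 1ℤ) ≡ coef 0 * c 0
    lowest = trans (unit (pow n m) (X (q + 1ℤ)))
                   (cong (λ i → coef 0 * (1ℤ * X i + 0ℤ)) (ℤP.+-comm q 1ℤ))
    factor : ∀ k a b x₀ x₁ → k * a * x₀ + k * b * x₁ ≡ k * (a * x₀ + b * x₁)
    factor = solve-∀
    higher : SA * X q + SB * X (q + 1ℤ) ≡ Σ[ 1 ⋯ m ] (λ s → coef s * c s)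
    higher = begin
      SA * X q + SB * X (q + 1ℤ)
        ≡⟨ cong₂ _+_ (sumFrom-*ʳ 1 m (X q) _) (sumFrom-*ʳ 1 m (X (q + 1ℤ)) _) ⟨
      sumFrom 1 m (λ s → coef s * Σ[ 1 ⋯ s ] (λ j → Eul s j * F (+ (j ℕ.+ s))) * X q)
        + sumFrom 1 m (λ s → coef s * Σ[ 1 ⋯ s ] (λ j → Eul s j * F (+ (j ℕ.+ s ℕ.+ 1))) * X (q + 1ℤ))
        ≡⟨ sumFrom-+ 1 m _ _ ⟨
      sumFrom 1 m (λ s → coef s * Σ[ 1 ⋯ s ] (λ j → Eul s j * F (+ (j ℕ.+ s))) * X q
                       + coef s * Σ[ 1 ⋯ s ] (λ j → Eul s j * F (+ (j ℕ.+ s ℕ.+ 1))) * X (q + 1ℤ))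
        ≡⟨ sumFrom-cong-< 1 m (λ s 1≤s _ → trans (factor (coef s) _ _ (X q) (X (q + 1ℤ)))
                                                 (cong (_*_ (coef s)) (Λ-pow-via-F s q 1≤s))) ⟩
      Σ[ 1 ⋯ m ] (λ s → coef s * c s) ∎

  sum-powers : ∀ m n r →
    Σ[ 1 ⋯ n ] (λ k → pow k m * X (+ k + r)) ≡
    P₁ m n * X (+ n + r) + P₂ m n * X (+ n + r + + 1)
      + (- (δ0 m * X r) + sgn (m ℕ.+ 1) * Λ m (λ x → pow x m) r)
  sum-powers m n r = begin
    sumFrom 1 n h                          ≡⟨ separate (h 0) (sumFrom 1 n h) ⟩
    (h 0 + sumFrom 1 n h) - h 0            ≡⟨ cong (_- h 0) telescoped ⟩
    (tail m 0 r - tail m (suc n) r) - h 0  ≡⟨ regroup (tail m 0 r) (tail m (suc n) r) (h 0) ⟩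
    - tail m (suc n) r + (- h 0 + tail m 0 r)
      ≡⟨ cong₂ _+_ (sym (P-combination m n r)) (cong₂ (λ a b → - a + b) first tail₀) ⟩
    P₁ m n * X (+ n + r) + P₂ m n * X (+ n + r + + 1)
      + (- (δ0 m * X r) + sgn (m ℕ.+ 1) * Λ m (λ x → pow x m) r) ∎
    where
    h : ℕ → ℤ
    h k = pow k m * X (+ k + r)
    separate : ∀ a s → s ≡ (a + s) - a
    separate = solve-∀
    regroup : ∀ t₀ t h → (t₀ - t) - h ≡ - t + (- h + t₀)
    regroup = solve-∀
    telescoped : h 0 + sumFrom 1 n h ≡ tail m 0 r - tail m (suc n) r
    telescoped = trans (sumFrom-cong 0 (suc n) λ k → sym (tail-step m k r))
                       (sumFrom-telescope 0 (suc n) (λ k → tail m k r))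
    first : h 0 ≡ δ0 m * X r
    first = cong₂ (λ p i → p * X i) (pow-0 m) (ℤP.+-identityˡ r)
    tail₀ : tail m 0 r ≡ sgn (m ℕ.+ 1) * Λ m (λ x → pow x m) r
    tail₀ = cong₂ (λ e i → sgn e * Λ m (λ x → pow x m) i) (ℕP.+-comm 1 m) (ℤP.+-identityˡ r)

mainTheorem6 : (m n : ℕ) (r : ℤ) →
    (Σ[ 1 ⋯ n ] (λ k → pow k m * F (+ k + r))
      ≡ P₁ m n * F (+ n + r) + P₂ m n * F (+ n + r + + 1) + Cc m r)
    × (Σ[ 1 ⋯ n ] (λ k → pow k m * L (+ k + r))
      ≡ P₁ m n * L (+ n + r) + P₂ m n * L (+ n + r + + 1) + Kc m r)
mainTheorem6 m n r = Fibonacci.sum-powers m n r , Lucas.sum-powers m n r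
  where
  module Fibonacci = FibonacciLike F (seqℤ-rec 0ℤ 1ℤ)
  module Lucas     = FibonacciLike L (seqℤ-rec (+ 2) 1ℤ)
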